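{- The Graphical Traveling Salesperson Problem has no mixed-integer programming formulation whose only integer variables are the edge variables $x_e$, $e \in E$. More precisely: it is not true that for every finite graph $G=(V,E)$ there exist $q \in \mathbb{Z}_{\geq 0}$, a matrix $A$, a matrix $B$ and a vector $d$ such that the set $Q = \{ (x,y) \in \mathbb{Z}^E \times \mathbb{R}^q : Ax + By \leq d \}$ has as its projection onto the $x$-variables exactly the set of feasible GTSP solutions $F(G)$.
   Context: Let $G=(V,E)$ be a finite graph. For $S \subseteq V$ let $\delta(S) = \{ e \in E : |e \cap S| = 1\}$ and $\delta(v) = \delta(\{v\})$. The set of feasible solutions of the Graphical Traveling Salesperson Problem (GTSP) on $G$ is $F(G) = \{ x \in \mathbb{Z}_{\geq 0}^E : \sum_{e \in \delta(S)} x_e \geq 2 \text{ for all } \varnothing \neq S \subsetneq V, \text{ and } \sum_{e \in \delta(v)} x_e \text{ is even for all } v \in V\}$; $x_e$ indicates how often edge $e$ is traversed by a tour visiting every node at least once (i.e. the multi-subgraph with $x_e$ copies of $e$ is spanning, connected and Eulerian). Given costs $c \in \mathbb{R}^E$, the GTSP asks to minimize $c^\top x$ over $x \in F(G)$. A mixed-integer programming formulation with integrality only on the $x$-variables is a set $Q = \{ (x,y) \in \mathbb{Z}^E \times \mathbb{R}^q : Ax + By \leq d \}$ (with $A,B,d$ real of appropriate dimensions) whose projection onto the $x$-coordinates equals $F(G)$, so that $\min\{c^\top x : (x,y) \in Q\}$ is equivalent to the GTSP. -}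

module Defs where

open import Level using (0ℓ)
open import Data.Nat using (ℕ; zero; suc)
open import Data.Integer as ℤ using (ℤ; +_; -[1+_])
open import Data.Fin using (Fin; zero; suc)
open import Data.Bool using (Bool; true; false; _xor_; if_then_else_)
open import Data.Product using (Σ; ∃; _×_; _,_)
open import Data.Sum using (_⊎_)
open import Data.Fin using (_≟_)
open import Relation.Nullary using (yes; no)
open import Relation.Nullary using (¬_)
open import Relation.Binary.PropositionalEquality using (_≡_)
open import Algebra.Bundles using (CommutativeRing)

record OrderedField : Set₁ where
  field
    commRing : CommutativeRing 0ℓ 0ℓ
  open CommutativeRing commRing public
  field
    _≤_        : Carrier → Carrier → Set
    ≤-refl     : ∀ {x y} → x ≈ y → x ≤ y
    ≤-antisym  : ∀ {x y} → x ≤ y → y ≤ x → x ≈ y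
    ≤-trans    : ∀ {x y z} → x ≤ y → y ≤ z → x ≤ z
    ≤-total    : ∀ x y → (x ≤ y) ⊎ (y ≤ x)
    +-mono-≤   : ∀ {x y} z → x ≤ y → (x + z) ≤ (y + z)
    *-nonneg   : ∀ {x y} → 0# ≤ x → 0# ≤ y → 0# ≤ (x * y)
    1≉0        : ¬ (1# ≈ 0#)
    inverse    : ∀ x → ¬ (x ≈ 0#) → Σ Carrier (λ y → (x * y) ≈ 1#)

sumℤ : ∀ {m} → (Fin m → ℤ) → ℤ
sumℤ {zero}  f = + 0
sumℤ {suc m} f = f zero ℤ.+ sumℤ (λ i → f (suc i))

module _ (K : OrderedField) where
  open OrderedField K using (Carrier; _+_; -_; 0#; 1#)

  sumK : ∀ {m} → (Fin m → Carrier) → Carrier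
  sumK {zero}  f = 0#
  sumK {suc m} f = f zero + sumK (λ i → f (suc i))

  ℕ→K : ℕ → Carrier
  ℕ→K zero    = 0#
  ℕ→K (suc n) = 1# + ℕ→K n

  ℤ→K : ℤ → Carrier
  ℤ→K (+ n)      = ℕ→K n
  ℤ→K -[1+ n ]   = - (ℕ→K (suc n))

record Graph : Set where
  field
    n m     : ℕ
    end₁    : Fin m → Fin n
    end₂    : Fin m → Fin n
    loopless : ∀ e → ¬ (end₁ e ≡ end₂ e)
    simple  : ∀ e f → ((end₁ e ≡ end₁ f × end₂ e ≡ end₂ f)
                       ⊎ (end₁ e ≡ end₂ f × end₂ e ≡ end₁ f)) → e ≡ f

module _ (G : Graph) where
  open Graph G

  -- vertex subsets as characteristic functions
  -- e ∈ δ(S) iff exactly one endpoint of e lies in S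
  inCut : (Fin n → Bool) → Fin m → Bool
  inCut S e = S (end₁ e) xor S (end₂ e)

  cutSum : (Fin n → Bool) → (Fin m → ℤ) → ℤ
  cutSum S x = sumℤ (λ e → if inCut S e then x e else (+ 0))

  singleton : Fin n → Fin n → Bool
  singleton v w with v ≟ w
  ... | yes _ = true
  ... | no  _ = false

  NonemptyProper : (Fin n → Bool) → Set
  NonemptyProper S = Σ (Fin n) (λ v → S v ≡ true) × Σ (Fin n) (λ w → S w ≡ false)

  Even : ℤ → Set
  Even z = Σ ℤ (λ k → z ≡ k ℤ.+ k)

  Feasible : (Fin m → ℤ) → Set
  Feasible x =
    (∀ e → + 0 ℤ.≤ x e) ×
    (∀ S → NonemptyProper S → + 2 ℤ.≤ cutSum S x) ×
    (∀ v → Even (cutSum (singleton v) x))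

record MIPFormulation (K : OrderedField) (G : Graph) : Set where
  open OrderedField K using (Carrier; _+_; _*_; _≤_)
  open Graph G using (m)
  field
    q r : ℕ
    A   : Fin r → Fin m → Carrier
    B   : Fin r → Fin q → Carrier
    d   : Fin r → Carrier

  InQ : (Fin m → ℤ) → (Fin q → Carrier) → Set
  InQ x y = ∀ i → (sumK K (λ e → A i e * ℤ→K K (x e)) + sumK K (λ j → B i j * y j)) ≤ d i

  IsFormulation : Set
  IsFormulation = ∀ (x : Fin m → ℤ) →
    (Feasible G x → Σ (Fin q → Carrier) (λ y → InQ x y)) ×
    (Σ (Fin q → Carrier) (λ y → InQ x y) → Feasible G x)

module Submission where

open import Defs
open import Data.Product using (Σ; _,_; proj₁; proj₂)
open import Relation.Nullary using (¬_)
open import Data.Nat as ℕ using (zero; suc)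
import Data.Nat.Properties as ℕ
open import Data.Integer as ℤ using (ℤ; +_; -[1+_])
import Data.Integer.Properties as ℤ
open import Data.Fin using (Fin; zero; suc)
open import Data.Bool using (true; _xor_)
open import Data.Sum using (inj₁; inj₂)
open import Relation.Binary.PropositionalEquality as ≡ using (_≡_; _≢_)

-- The solutions (x, y) of a linear system A x + B y ≤ d form a convex set,
-- so averaging completions of two feasible x and x′ completes (x + x′)/2
-- whenever that is integral.  On the graph with a single edge, x = 2 and
-- x = 4 are tours but x = 3 is not, since it gives both endpoints odd degree.

module OrderedFieldProperties (K : OrderedField) where
  open OrderedField K hiding (zero)
  open import Algebra.Properties.Ring ring
    using (//-rightDividesˡ; -‿distribˡ-*; -‿distribʳ-*; -‿involutive)
  open import Algebra.Solver.Ring.NaturalCoefficients.Default commutativeSemiring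
  open import Relation.Binary.Reasoning.Setoid setoid

  ≤-resp-≈ : ∀ {x x′ y y′} → x ≈ x′ → y ≈ y′ → x ≤ y → x′ ≤ y′
  ≤-resp-≈ x≈x′ y≈y′ x≤y = ≤-trans (≤-refl (sym x≈x′)) (≤-trans x≤y (≤-refl y≈y′))

  +-mono-≤₂ : ∀ {x x′ y y′} → x ≤ x′ → y ≤ y′ → (x + y) ≤ (x′ + y′)
  +-mono-≤₂ {x′ = x′} {y} {y′} x≤x′ y≤y′ =
    ≤-trans (+-mono-≤ y x≤x′) (≤-resp-≈ (+-comm y x′) (+-comm y′ x′) (+-mono-≤ x′ y≤y′))

  x≤y⇒0≤y-x : ∀ {x y} → x ≤ y → 0# ≤ (y - x)
  x≤y⇒0≤y-x {x} x≤y = ≤-resp-≈ (-‿inverseʳ x) refl (+-mono-≤ (- x) x≤y)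

  *-monoˡ-≤ : ∀ {c x y} → 0# ≤ c → x ≤ y → (c * x) ≤ (c * y)
  *-monoˡ-≤ {c} {x} {y} 0≤c x≤y =
    ≤-resp-≈ (+-identityˡ (c * x)) c[y-x]+cx≈cy
      (+-mono-≤ (c * x) (*-nonneg 0≤c (x≤y⇒0≤y-x x≤y)))
    where
    c[y-x]+cx≈cy : (c * (y - x) + c * x) ≈ (c * y)
    c[y-x]+cx≈cy = begin
      c * (y - x) + c * x ≈⟨ sym (distribˡ c (y - x) x) ⟩
      c * ((y - x) + x)   ≈⟨ *-cong refl (//-rightDividesˡ x y) ⟩
      c * y               ∎

  -x*-x≈x*x : ∀ x → ((- x) * (- x)) ≈ (x * x)
  -x*-x≈x*x x = begin
    (- x) * (- x) ≈⟨ sym (-‿distribˡ-* x (- x)) ⟩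
    - (x * (- x)) ≈⟨ -‿cong (sym (-‿distribʳ-* x x)) ⟩
    - (- (x * x)) ≈⟨ -‿involutive (x * x) ⟩
    x * x         ∎

  0≤x*x : ∀ x → 0# ≤ (x * x)
  0≤x*x x with ≤-total 0# x
  ... | inj₁ 0≤x = *-nonneg 0≤x 0≤x
  ... | inj₂ x≤0 = ≤-resp-≈ refl (-x*-x≈x*x x) (*-nonneg 0≤-x 0≤-x)
    where
    0≤-x : 0# ≤ (- x)
    0≤-x = ≤-resp-≈ refl (+-identityˡ (- x)) (x≤y⇒0≤y-x x≤0)

  0≤1 : 0# ≤ 1#
  0≤1 = ≤-resp-≈ refl (*-identityˡ 1#) (0≤x*x 1#)

  1+1≉0 : ¬ ((1# + 1#) ≈ 0#)
  1+1≉0 2≈0 = 1≉0 (≤-antisym (≤-trans 1≤2 (≤-refl 2≈0)) 0≤1)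
    where
    1≤2 : 1# ≤ (1# + 1#)
    1≤2 = ≤-resp-≈ (+-identityˡ 1#) refl (+-mono-≤ 1# 0≤1)

  ½ : Carrier
  ½ = proj₁ (inverse (1# + 1#) 1+1≉0)

  ½*[x+x]≈x : ∀ x → (½ * (x + x)) ≈ x
  ½*[x+x]≈x x = begin
    ½ * (x + x)          ≈⟨ solve 2 (λ h x → h :* (x :+ x) := ((con 1 :+ con 1) :* h) :* x) refl ½ x ⟩
    ((1# + 1#) * ½) * x  ≈⟨ *-cong (proj₂ (inverse (1# + 1#) 1+1≉0)) refl ⟩
    1# * x               ≈⟨ *-identityˡ x ⟩
    x                    ∎

  0≤½ : 0# ≤ ½
  0≤½ = ≤-resp-≈ (+-identityˡ 0#) ½*½+½*½≈½ (+-mono-≤₂ (0≤x*x ½) (0≤x*x ½))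
    where
    ½*½+½*½≈½ : (½ * ½ + ½ * ½) ≈ ½
    ½*½+½*½≈½ = trans (sym (distribˡ ½ ½ ½)) (½*[x+x]≈x ½)

  midpoint : Carrier → Carrier → Carrier
  midpoint x y = ½ * (x + y)

  midpoint-≤ : ∀ {x y z} → x ≤ z → y ≤ z → midpoint x y ≤ z
  midpoint-≤ {z = z} x≤z y≤z =
    ≤-resp-≈ refl (½*[x+x]≈x z) (*-monoˡ-≤ 0≤½ (+-mono-≤₂ x≤z y≤z))

  midpoint-+ : ∀ a b c d → (midpoint a b + midpoint c d) ≈ midpoint (a + c) (b + d)
  midpoint-+ = solve 5
    (λ h a b c d → h :* (a :+ b) :+ h :* (c :+ d) := h :* ((a :+ c) :+ (b :+ d))) refl ½

  *-midpoint : ∀ c x y → (c * midpoint x y) ≈ midpoint (c * x) (c * y)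
  *-midpoint = solve 4 (λ h c x y → c :* (h :* (x :+ y)) := h :* (c :* x :+ c :* y)) refl ½

  ℕ→K-midpoint : ∀ n → ℕ→K K (suc n) ≈ midpoint (ℕ→K K n) (ℕ→K K (suc (suc n)))
  ℕ→K-midpoint n = begin
    ℕ→K K (suc n)              ≈⟨ sym (½*[x+x]≈x (1# + a)) ⟩
    ½ * ((1# + a) + (1# + a))  ≈⟨ *-cong refl (solve 1 (λ a →
                                     (con 1 :+ a) :+ (con 1 :+ a) := a :+ (con 1 :+ (con 1 :+ a))) refl a) ⟩
    midpoint a (1# + (1# + a)) ∎
    where a = ℕ→K K n

  sumK-cong : ∀ {k} {u v : Fin k → Carrier} → (∀ j → u j ≈ v j) → sumK K u ≈ sumK K v
  sumK-cong {zero}  u≈v = refl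
  sumK-cong {suc k} u≈v = +-cong (u≈v zero) (sumK-cong (λ j → u≈v (suc j)))

  sumK-midpoint : ∀ {k} (u v : Fin k → Carrier) →
                  sumK K (λ j → midpoint (u j) (v j)) ≈ midpoint (sumK K u) (sumK K v)
  sumK-midpoint {zero}  u v = solve 1 (λ h → con 0 := h :* (con 0 :+ con 0)) refl ½
  sumK-midpoint {suc k} u v = begin
    midpoint (u zero) (v zero) + sumK K (λ j → midpoint (u (suc j)) (v (suc j)))
      ≈⟨ +-cong refl (sumK-midpoint (λ j → u (suc j)) (λ j → v (suc j))) ⟩
    midpoint (u zero) (v zero) + midpoint (sumK K (λ j → u (suc j))) (sumK K (λ j → v (suc j)))
      ≈⟨ midpoint-+ _ _ _ _ ⟩
    midpoint (sumK K u) (sumK K v) ∎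

  linear-midpoint : ∀ {k} (c u v : Fin k → Carrier) →
                    sumK K (λ j → c j * midpoint (u j) (v j))
                      ≈ midpoint (sumK K (λ j → c j * u j)) (sumK K (λ j → c j * v j))
  linear-midpoint c u v =
    trans (sumK-cong (λ j → *-midpoint (c j) (u j) (v j)))
          (sumK-midpoint (λ j → c j * u j) (λ j → c j * v j))

module _ {K : OrderedField} {G : Graph} (P : MIPFormulation K G) where
  open OrderedField K hiding (zero)
  open OrderedFieldProperties K
  open MIPFormulation P
  open Graph G using (m)

  InQ-midpoint : ∀ x x′ x″ {y y′ : Fin q → Carrier} →
                 (∀ e → ℤ→K K (x″ e) ≈ midpoint (ℤ→K K (x e)) (ℤ→K K (x′ e))) →
                 InQ x y → InQ x′ y′ → InQ x″ (λ j → midpoint (y j) (y′ j))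
  InQ-midpoint x x′ x″ {y} {y′} x″≈mid Qxy Qx′y′ i =
    ≤-resp-≈ (sym row-midpoint) refl (midpoint-≤ (Qxy i) (Qx′y′ i))
    where
    open import Relation.Binary.Reasoning.Setoid setoid
    Ax : (Fin m → ℤ) → Carrier
    Ax x = sumK K (λ e → A i e * ℤ→K K (x e))
    By : (Fin q → Carrier) → Carrier
    By y = sumK K (λ j → B i j * y j)
    row-midpoint : (Ax x″ + By (λ j → midpoint (y j) (y′ j)))
                     ≈ midpoint (Ax x + By y) (Ax x′ + By y′)
    row-midpoint = begin
      Ax x″ + By (λ j → midpoint (y j) (y′ j))
        ≈⟨ +-cong (sumK-cong (λ e → *-cong refl (x″≈mid e))) refl ⟩
      sumK K (λ e → A i e * midpoint (ℤ→K K (x e)) (ℤ→K K (x′ e))) + By (λ j → midpoint (y j) (y′ j))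
        ≈⟨ +-cong (linear-midpoint (A i) _ _) (linear-midpoint (B i) y y′) ⟩
      midpoint (Ax x) (Ax x′) + midpoint (By y) (By y′)
        ≈⟨ midpoint-+ _ _ _ _ ⟩
      midpoint (Ax x + By y) (Ax x′ + By y′) ∎

K₂ : Graph
K₂ = record
  { n = 2 ; m = 1 ; end₁ = λ _ → zero ; end₂ = λ _ → suc zero
  ; loopless = λ _ () ; simple = λ { zero zero _ → ≡.refl } }

edge-in-cut : ∀ S → NonemptyProper K₂ S → S zero xor S (suc zero) ≡ true
edge-in-cut S ((zero , Sv) , (suc zero , Sw))     rewrite Sv | Sw = ≡.refl
edge-in-cut S ((suc zero , Sv) , (zero , Sw))     rewrite Sv | Sw = ≡.refl
edge-in-cut S ((zero , Sv) , (zero , Sw))         with () ← ≡.trans (≡.sym Sv) Sw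
edge-in-cut S ((suc zero , Sv) , (suc zero , Sw)) with () ← ≡.trans (≡.sym Sv) Sw

cutSum-K₂ : ∀ S x → NonemptyProper K₂ S → cutSum K₂ S x ≡ x zero
cutSum-K₂ S x S-proper rewrite edge-in-cut S S-proper = ℤ.+-identityʳ (x zero)

singleton-nonemptyProper : ∀ v → NonemptyProper K₂ (singleton K₂ v)
singleton-nonemptyProper zero       = (zero , ≡.refl) , (suc zero , ≡.refl)
singleton-nonemptyProper (suc zero) = (suc zero , ≡.refl) , (zero , ≡.refl)

degree-K₂ : ∀ v x → cutSum K₂ (singleton K₂ v) x ≡ x zero
degree-K₂ v x = cutSum-K₂ (singleton K₂ v) x (singleton-nonemptyProper v)

even-feasible : ∀ k → Feasible K₂ (λ _ → + suc k ℤ.+ + suc k)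
even-feasible k = (λ _ → ℤ.+≤+ ℕ.z≤n) , cut≥2 , degree-even
  where
  2≤2k+2 : 2 ℕ.≤ suc k ℕ.+ suc k
  2≤2k+2 = ℕ.s≤s (ℕ.≤-trans (ℕ.s≤s ℕ.z≤n) (ℕ.m≤n+m (suc k) k))
  cut≥2 : ∀ S → NonemptyProper K₂ S → + 2 ℤ.≤ cutSum K₂ S (λ _ → + suc k ℤ.+ + suc k)
  cut≥2 S S-proper rewrite cutSum-K₂ S (λ _ → + suc k ℤ.+ + suc k) S-proper = ℤ.+≤+ 2≤2k+2
  degree-even : ∀ v → Even K₂ (cutSum K₂ (singleton K₂ v) (λ _ → + suc k ℤ.+ + suc k))
  degree-even v = + suc k , degree-K₂ v (λ _ → + suc k ℤ.+ + suc k)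

odd≢double : ∀ k z → + suc (2 ℕ.* k) ≢ z ℤ.+ z
odd≢double k -[1+ _ ] ()
odd≢double k (+ j) 2k+1≡j+j = ℕ.even≢odd j k (begin
  2 ℕ.* j       ≡⟨ ≡.cong (j ℕ.+_) (ℕ.+-identityʳ j) ⟩
  j ℕ.+ j       ≡⟨ ℤ.+-injective 2k+1≡j+j ⟨
  suc (2 ℕ.* k) ∎)
  where open ≡.≡-Reasoning

odd-infeasible : ∀ k → ¬ Feasible K₂ (λ _ → + suc (2 ℕ.* k))
odd-infeasible k (_ , _ , degree-even) =
  let (z , degree≡z+z) = degree-even zero
  in odd≢double k z (≡.trans (≡.sym (degree-K₂ zero (λ _ → + suc (2 ℕ.* k)))) degree≡z+z)

theorem1 : (K : OrderedField) →
    ¬ ((G : Graph) → Σ (MIPFormulation K G) (λ P → MIPFormulation.IsFormulation P))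
theorem1 K formulation with formulation K₂
... | P , isFormulation with proj₁ (isFormulation (λ _ → + 2)) (even-feasible 0)
                           | proj₁ (isFormulation (λ _ → + 4)) (even-feasible 1)
...   | _ , Q₂ | _ , Q₄ =
  odd-infeasible 1 (proj₂ (isFormulation (λ _ → + 3))
    (_ , InQ-midpoint P (λ _ → + 2) (λ _ → + 4) (λ _ → + 3) (λ _ → ℕ→K-midpoint 2) Q₂ Q₄))
  where open OrderedFieldProperties K
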